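{- Let $F$ be a clause set. If the reasoning algorithm with inference rules A1, A2, and A3, started from $\mathcal{S}_0=\{F\}$, yields a complete and clash-free family of clause sets $\mathcal{S}_n$, then $F$ is satisfiable.
   Context: $\mathcal{ALC}$ interpretations $\mathcal{I}=(\Delta^\mathcal{I},\cdot^\mathcal{I})$ with the standard semantics of $\lnot,\sqcap,\sqcup,\forall R.,\exists R.$. Conjunctive normal forms are defined by mutual induction: a concept literal is $A$, $\lnot A$ ($A$ a concept name), $\exists R.F$ or $\forall R.F$ ($R$ a role name, $F$ a conjunctive normal form); a clause is a finite disjunction of concept literals, represented as a set of literals; a conjunctive normal form is a finite conjunction of clauses, represented as a clause set. A clause set $F$ denotes the conjunction of its clauses, each clause the disjunction of its literals; $F$ is satisfiable if $F^\mathcal{I}\neq\emptyset$ for some interpretation $\mathcal{I}$. The complementary literal $\overline{L}$ is: $\overline{A}=\lnot A$, $\overline{\lnot A}=A$, $\overline{\exists R.F}=\forall R.\mathrm{CNF}(\lnot F)$, $\overline{\forall R.F}=\exists R.\mathrm{CNF}(\lnot F)$, with $\mathrm{CNF}(C)$ the equivalent conjunctive normal form of $C$ (push negations inward, distribute $\sqcup$ over $\sqcap$, flatten). A derivation works on families of clause sets $\mathcal{S}_i$, starting with $\mathcal{S}_0=\{F\}$; $\mathcal{S}_{i+1}$ is obtained from $\mathcal{S}_i$ by applying one of the following rules to a clause set $F\in\mathcal{S}_i$: (A1) if $L\in CL$ for a clause $CL\in F$: replace $CL$ by $\{L\}$ (nondeterministic choice of $L$). (A2) if $\forall R.F_1\in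 CL$ for some clause $CL\in F$: remove from $F$ all clauses containing $\forall R.F_1$, and replace every literal $\exists R.F_2$ occurring in clauses of $F$ by $\exists R.(F_1\cup F_2)$. (A3) if all clauses of $F$ are unit clauses of the form $\{A\}$, $\{\lnot A\}$ or $\{\exists R.F'\}$: for some $\{\exists R.F_1\}\in F$, replace $F$ by $F\setminus\{\{\exists R.F_1\}\}$ and add $F_1$ to the family ($F$ is the parent of $F_1$ with respect to $R$). A family is complete if no rule is applicable to it. It is clash-free if no clause set in it contains the empty clause or contains both $\{L\}$ and $\{\overline{L}\}$ for some literal $L$. -}

module Defs where

open import Data.Nat using (ℕ; _≤_; _≟_)
open import Data.List using (List; []; _∷_; _++_; map; concatMap; length)
open import Data.List.Membership.Propositional using (_∈_; _∉_)
open import Data.List.Relation.Unary.All using (All)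
open import Data.Product using (Σ; _×_; _,_; ∃)
open import Data.Sum using (_⊎_)
open import Data.Empty using (⊥)
open import Data.Unit using (⊤)
open import Relation.Nullary using (¬_; yes; no)
open import Relation.Binary.PropositionalEquality using (_≡_)
open import Relation.Binary.Construct.Closure.ReflexiveTransitive using (Star)

-- Concept names and role names are natural numbers.
-- A clause is a finite disjunction of literals (a list of literals),
-- a clause set (CNF) is a finite conjunction of clauses (a list of clauses).

data Lit : Set where
  pos : ℕ → Lit
  neg : ℕ → Lit
  ex  : ℕ → List (List Lit) → Lit
  all : ℕ → List (List Lit) → Lit

Clause : Set
Clause = List Lit

CSet : Set
CSet = List Clause

-- CNF of a disjunction of two CNFs
cross : CSet → CSet → CSet
cross A B = concatMap (λ a → map (a ++_) B) A

mutual
  compL : Lit → Lit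
  compL (pos A)   = neg A
  compL (neg A)   = pos A
  compL (ex R G)  = all R (negCNF G)
  compL (all R G) = ex R (negCNF G)

  negClause : Clause → CSet
  negClause []      = []
  negClause (L ∷ C) = (compL L ∷ []) ∷ negClause C

  -- CNF(¬ F): ¬ ⊤ = {∅}, ¬(C ⊓ G) = ¬C ⊔ ¬G distributed
  negCNF : CSet → CSet
  negCNF []      = [] ∷ []
  negCNF (C ∷ G) = cross (negClause C) (negCNF G)

record Interp : Set₁ where
  field
    Δ    : Set
    conc : ℕ → Δ → Set
    role : ℕ → Δ → Δ → Set

module _ (I : Interp) where
  open Interp I

  mutual
    satL : Lit → Δ → Set
    satL (pos A)   d = conc A d
    satL (neg A)   d = ¬ conc A d
    satL (ex R G)  d = Σ Δ λ e → role R d e × satS G e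
    satL (all R G) d = (e : Δ) → role R d e → satS G e

    satC : Clause → Δ → Set
    satC []      d = ⊥
    satC (L ∷ C) d = satL L d ⊎ satC C d

    satS : CSet → Δ → Set
    satS []      d = ⊤
    satS (C ∷ F) d = satC C d × satS F d

Satisfiable : CSet → Set₁
Satisfiable F = Σ Interp λ I → Σ (Interp.Δ I) λ d → satS I F d

Family : Set
Family = List CSet

extendL : ℕ → CSet → Lit → Lit
extendL R F₁ (ex S G) with S ≟ R
... | yes _ = ex S (F₁ ++ G)
... | no  _ = ex S G
extendL R F₁ L = L

data A2Res (R : ℕ) (F₁ : CSet) : CSet → CSet → Set where
  done : A2Res R F₁ [] []
  drop : ∀ {CL F F'} → all R F₁ ∈ CL → A2Res R F₁ F F' →
         A2Res R F₁ (CL ∷ F) F'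
  keep : ∀ {CL F F'} → all R F₁ ∉ CL → A2Res R F₁ F F' →
         A2Res R F₁ (CL ∷ F) (map (extendL R F₁) CL ∷ F')

data A3Unit : Clause → Set where
  uPos : ∀ A → A3Unit (pos A ∷ [])
  uNeg : ∀ A → A3Unit (neg A ∷ [])
  uEx  : ∀ R G → A3Unit (ex R G ∷ [])

data NodeStep : CSet → CSet → Set where
  A1 : ∀ (xs ys : CSet) (CL : Clause) (L : Lit) →
       L ∈ CL → 2 ≤ length CL →
       NodeStep (xs ++ CL ∷ ys) (xs ++ (L ∷ []) ∷ ys)
  A2 : ∀ {F F'} (CL : Clause) (R : ℕ) (F₁ : CSet) →
       CL ∈ F → all R F₁ ∈ CL → A2Res R F₁ F F' → NodeStep F F'

data Step : Family → Family → Set where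
  node : ∀ (xs ys : Family) {F F'} → NodeStep F F' →
         Step (xs ++ F ∷ ys) (xs ++ F' ∷ ys)
  A3   : ∀ (xs ys : Family) (us vs : CSet) (R : ℕ) (F₁ : CSet) →
         All A3Unit (us ++ (ex R F₁ ∷ []) ∷ vs) →
         Step (xs ++ (us ++ (ex R F₁ ∷ []) ∷ vs) ∷ ys)
              (xs ++ (us ++ vs) ∷ ys ++ F₁ ∷ [])

Derivation : CSet → Family → Set
Derivation F S = Star Step (F ∷ []) S

A1Applicable : CSet → Set
A1Applicable F = Σ Clause λ CL → CL ∈ F × 2 ≤ length CL

A2Applicable : CSet → Set
A2Applicable F = Σ Clause λ CL → Σ ℕ λ R → Σ CSet λ F₁ → CL ∈ F × all R F₁ ∈ CL

A3Applicable : CSet → Set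
A3Applicable F = All A3Unit F × (Σ ℕ λ R → Σ CSet λ F₁ → (ex R F₁ ∷ []) ∈ F)

Complete : Family → Set
Complete S = ∀ F → F ∈ S →
  ¬ A1Applicable F × ¬ A2Applicable F × ¬ A3Applicable F

ClashFree : Family → Set
ClashFree S = ∀ F → F ∈ S →
  [] ∉ F × (∀ L → (L ∷ []) ∈ F → (compL L ∷ []) ∈ F → ⊥)

{-# OPTIONS --safe #-}
-- Every rule is sound backwards: a model of the clause sets after a step yields
-- a model of the clause sets before it, so a model of each node of the final
-- family gives a model of F.  A complete clash-free node consists of atomic
-- unit clauses only and is satisfied by a one-point interpretation without
-- roles.  A3 is reversed by gluing a fresh root R₀-linked to a model of F₁
-- beside a model of the rest of its parent.  Reversing A2 needs ∀R.F₁ at the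
-- root, so the models carried backwards are kept "justified": every
-- R-successor of the root satisfies some G for which ∃R.G occurs in the node.
-- After A2 that G has the form F₁ ∪ G', which gives ∀R.F₁.
module Submission where

open import Defs
open import Data.Nat using (ℕ; _≟_; s≤s; z≤n)
open import Data.List using ([]; _∷_; _++_; map)
open import Data.List.Membership.Propositional using (_∈_; _∉_)
open import Data.List.Membership.Propositional.Properties using (∈-++⁺ˡ; ∈-++⁺ʳ; ∈-++⁻; ∈-map⁻)
open import Data.List.Relation.Unary.Any using (here; there)
open import Data.List.Relation.Unary.All as All using (All; []; _∷_)
import Data.List.Relation.Unary.All.Properties as All
open import Data.Product using (Σ; _×_; _,_; proj₁; proj₂)
open import Data.Sum using (inj₁; inj₂)
open import Data.Empty using (⊥; ⊥-elim)
open import Data.Unit using (⊤; tt)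
open import Relation.Nullary using (¬_; yes; no)
open import Relation.Binary.PropositionalEquality using (_≡_; refl; sym)
open import Relation.Binary.Construct.Closure.ReflexiveTransitive using (Star; ε; _◅_)

open Interp

module _ (I : Interp) where

  satS-++⁻ : ∀ F {G d} → satS I (F ++ G) d → satS I F d × satS I G d
  satS-++⁻ []      s       = tt , s
  satS-++⁻ (C ∷ F) (c , s) with satS-++⁻ F s
  ... | sF , sG = (c , sF) , sG

  satS-++⁺ : ∀ F {G d} → satS I F d → satS I G d → satS I (F ++ G) d
  satS-++⁺ []      _       sG = sG
  satS-++⁺ (C ∷ F) (c , sF) sG = c , satS-++⁺ F sF sG

  satL⇒satC : ∀ {L C d} → L ∈ C → satL I L d → satC I C d
  satL⇒satC (here refl) s = inj₁ s
  satL⇒satC (there L∈C) s = inj₂ (satL⇒satC L∈C s)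

  satS-tabulate : ∀ F {d} → (∀ {C} → C ∈ F → satC I C d) → satS I F d
  satS-tabulate []      _    = tt
  satS-tabulate (C ∷ F) satF = satF (here refl) , satS-tabulate F (λ C∈F → satF (there C∈F))

OccursEx : ℕ → CSet → CSet → Set
OccursEx R G F = Σ Clause λ C → C ∈ F × ex R G ∈ C

Justified : (I : Interp) → CSet → Δ I → Set
Justified I F d = ∀ R e → role I R d e → Σ CSet λ G → OccursEx R G F × satS I G e

JustifiedlySatisfiable : CSet → Set₁
JustifiedlySatisfiable F = Σ Interp λ I → Σ (Δ I) λ d → satS I F d × Justified I F d

a1-reflects : ∀ xs ys C {L} → L ∈ C →
  JustifiedlySatisfiable (xs ++ (L ∷ []) ∷ ys) → JustifiedlySatisfiable (xs ++ C ∷ ys)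
a1-reflects xs ys C L∈C (I , d , s , just) = I , d , sat , justified
  where
    sat : satS I (xs ++ C ∷ ys) d
    sat with satS-++⁻ I xs s
    ... | sxs , (inj₁ sL , sys) = satS-++⁺ I xs sxs (satL⇒satC I L∈C sL , sys)

    justified : Justified I (xs ++ C ∷ ys) d
    justified R e r with just R e r
    ... | G , (D , D∈ , ex∈D) , sG with ∈-++⁻ xs D∈
    ... | inj₁ D∈xs         = G , (D , ∈-++⁺ˡ D∈xs , ex∈D) , sG
    ... | inj₂ (there D∈ys) = G , (D , ∈-++⁺ʳ xs (there D∈ys) , ex∈D) , sG
    ... | inj₂ (here refl) with ex∈D
    ... | here refl = G , (C , ∈-++⁺ʳ xs (here refl) , L∈C) , sG

module _ (I : Interp) (R : ℕ) (F₁ : CSet) where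

  extendL-sound : ∀ L {d} → satL I (extendL R F₁ L) d → satL I L d
  extendL-sound (pos A) s = s
  extendL-sound (neg A) s = s
  extendL-sound (all S G) s = s
  extendL-sound (ex S G) s with S ≟ R
  ... | yes _ = let (e , r , sG) = s in e , r , proj₂ (satS-++⁻ I F₁ sG)
  ... | no  _ = s

  map-extendL-sound : ∀ C {d} → satC I (map (extendL R F₁) C) d → satC I C d
  map-extendL-sound (L ∷ C) (inj₁ s) = inj₁ (extendL-sound L s)
  map-extendL-sound (L ∷ C) (inj₂ s) = inj₂ (map-extendL-sound C s)

  A2Res-sound : ∀ {F F' d} → A2Res R F₁ F F' →
    satL I (all R F₁) d → satS I F' d → satS I F d
  A2Res-sound done             _  _          = tt
  A2Res-sound (drop ∀∈C res)   s∀ sF'        = satL⇒satC I ∀∈C s∀ , A2Res-sound res s∀ sF'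
  A2Res-sound (keep {C} _ res) s∀ (sC , sF') = map-extendL-sound C sC , A2Res-sound res s∀ sF'

  extendL-ex-sound : ∀ L {R' G e} → extendL R F₁ L ≡ ex R' G → satS I G e →
    Σ CSet λ G' → L ≡ ex R' G' × satS I G' e × (R' ≡ R → satS I F₁ e)
  extendL-ex-sound (ex S H) _ _ with S ≟ R
  extendL-ex-sound (ex S H) refl sG | yes S≡R =
    H , refl , proj₂ (satS-++⁻ I F₁ sG) , λ _ → proj₁ (satS-++⁻ I F₁ sG)
  extendL-ex-sound (ex S H) refl sH | no S≢R = H , refl , sH , λ S≡R → ⊥-elim (S≢R S≡R)

  A2Res-occursEx : ∀ {F F' R' G e} → A2Res R F₁ F F' → OccursEx R' G F' → satS I G e →
    Σ CSet λ G' → OccursEx R' G' F × satS I G' e × (R' ≡ R → satS I F₁ e)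
  A2Res-occursEx (drop _ res) occ sG with A2Res-occursEx res occ sG
  ... | G' , (D , D∈ , ex∈D) , rest = G' , (D , there D∈ , ex∈D) , rest
  A2Res-occursEx (keep {C} _ res) (_ , here refl , ex∈) sG with ∈-map⁻ (extendL R F₁) ex∈
  ... | L , L∈C , eq with extendL-ex-sound L (sym eq) sG
  ... | G' , refl , rest = G' , (C , here refl , L∈C) , rest
  A2Res-occursEx (keep _ res) (D , there D∈ , ex∈D) sG with A2Res-occursEx res (D , D∈ , ex∈D) sG
  ... | G' , (D' , D'∈ , ex∈D') , rest = G' , (D' , there D'∈ , ex∈D') , rest

a2-reflects : ∀ {R F₁ F F'} → A2Res R F₁ F F' →
  JustifiedlySatisfiable F' → JustifiedlySatisfiable F
a2-reflects {R} {F₁} res (I , d , sF' , just) = I , d , A2Res-sound I R F₁ res s∀ sF' , justified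
  where
    s∀ : satL I (all R F₁) d
    s∀ e r with just R e r
    ... | G , occ , sG with A2Res-occursEx I R F₁ res occ sG
    ... | _ , _ , _ , sF₁ = sF₁ refl

    justified : Justified I _ d
    justified R' e r with just R' e r
    ... | G , occ , sG with A2Res-occursEx I R F₁ res occ sG
    ... | G' , occ' , sG' , _ = G' , occ' , sG'

nodeStep-reflects : ∀ {F F'} → NodeStep F F' →
  JustifiedlySatisfiable F' → JustifiedlySatisfiable F
nodeStep-reflects (A1 xs ys C L L∈C _) = a1-reflects xs ys C L∈C
nodeStep-reflects (A2 _ _ _ _ _ res)   = a2-reflects res

record BoundedMorphism (I J : Interp) : Set where
  field
    to    : Δ I → Δ J
    conc⁺ : ∀ {A x} → conc I A x → conc J A (to x)
    conc⁻ : ∀ {A x} → conc J A (to x) → conc I A x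
    forth : ∀ {R x y} → role I R x y → role J R (to x) (to y)
    back  : ∀ {R x} z → role J R (to x) z → Σ (Δ I) λ y → to y ≡ z × role I R x y

module _ {I J : Interp} (h : BoundedMorphism I J) where
  open BoundedMorphism h

  mutual
    satL-to : ∀ L {x} → satL I L x → satL J L (to x)
    satL-to (pos A)   s          = conc⁺ s
    satL-to (neg A)   s          = λ c → s (conc⁻ c)
    satL-to (ex R G)  (y , r , s) = to y , forth r , satS-to G s
    satL-to (all R G) s z r with back z r
    ... | y , refl , r' = satS-to G (s y r')

    satC-to : ∀ C {x} → satC I C x → satC J C (to x)
    satC-to (L ∷ C) (inj₁ s) = inj₁ (satL-to L s)
    satC-to (L ∷ C) (inj₂ s) = inj₂ (satC-to C s)

    satS-to : ∀ F {x} → satS I F x → satS J F (to x)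
    satS-to []      _        = tt
    satS-to (C ∷ F) (sC , sF) = satC-to C sC , satS-to F sF

data Glued (X Y : Set) : Set where
  root : Glued X Y
  inl  : X → Glued X Y
  inr  : Y → Glued X Y

module Glue (I J : Interp) (d : Δ I) (R₀ : ℕ) (e : Δ J) where

  glued-role : ℕ → Glued (Δ I) (Δ J) → Glued (Δ I) (Δ J) → Set
  glued-role R root    (inl x)  = role I R d x
  glued-role R root    (inr y)  = R ≡ R₀ × y ≡ e
  glued-role R (inl x) (inl x') = role I R x x'
  glued-role R (inr y) (inr y') = role J R y y'
  glued-role _ _       _        = ⊥

  glued-conc : ℕ → Glued (Δ I) (Δ J) → Set
  glued-conc A root    = conc I A d
  glued-conc A (inl x) = conc I A x
  glued-conc A (inr y) = conc J A y

  U : Interp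
  U = record { Δ = Glued (Δ I) (Δ J) ; conc = glued-conc ; role = glued-role }

  inl-bounded : BoundedMorphism I U
  inl-bounded = record
    { to = inl ; conc⁺ = λ c → c ; conc⁻ = λ c → c ; forth = λ r → r
    ; back = λ { (inl y) r → y , refl , r } }

  inr-bounded : BoundedMorphism J U
  inr-bounded = record
    { to = inr ; conc⁺ = λ c → c ; conc⁻ = λ c → c ; forth = λ r → r
    ; back = λ { (inr y) r → y , refl , r } }

  root-units : ∀ F → All A3Unit F → satS I F d → satS U F root
  root-units []      []             _                          = tt
  root-units (_ ∷ F) (uPos A ∷ us)  (sC , sF)                  = sC , root-units F us sF
  root-units (_ ∷ F) (uNeg A ∷ us)  (sC , sF)                  = sC , root-units F us sF
  root-units (_ ∷ F) (uEx R G ∷ us) (inj₁ (x , r , sG) , sF) =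
    inj₁ (inl x , r , satS-to inl-bounded G sG) , root-units F us sF

a3-reflects : ∀ us vs R₀ F₁ → All A3Unit (us ++ (ex R₀ F₁ ∷ []) ∷ vs) →
  JustifiedlySatisfiable (us ++ vs) → JustifiedlySatisfiable F₁ →
  JustifiedlySatisfiable (us ++ (ex R₀ F₁ ∷ []) ∷ vs)
a3-reflects us vs R₀ F₁ units (I , d , s , just) (J , e , sF₁ , _) = U , root , sat , justified
  where
    open Glue I J d R₀ e

    sF₁-at-e : satS U F₁ (inr e)
    sF₁-at-e = satS-to inr-bounded F₁ sF₁

    sat : satS U (us ++ (ex R₀ F₁ ∷ []) ∷ vs) root
    sat with All.++⁻ us units | satS-++⁻ I us s
    ... | uus , (_ ∷ uvs) | sus , svs =
      satS-++⁺ U us (root-units us uus sus)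
        (inj₁ (inr e , (refl , refl) , sF₁-at-e) , root-units vs uvs svs)

    justified : Justified U (us ++ (ex R₀ F₁ ∷ []) ∷ vs) root
    justified R (inl x) r with just R x r
    ... | G , (C , C∈ , ex∈C) , sG with ∈-++⁻ us C∈
    ... | inj₁ C∈us = G , (C , ∈-++⁺ˡ C∈us , ex∈C) , satS-to inl-bounded G sG
    ... | inj₂ C∈vs = G , (C , ∈-++⁺ʳ us (there C∈vs) , ex∈C) , satS-to inl-bounded G sG
    justified R (inr y) (refl , refl) =
      F₁ , ((ex R₀ F₁ ∷ []) , ∈-++⁺ʳ us (here refl) , here refl) , sF₁-at-e

step-reflects : ∀ {S S'} → Step S S' →
  All JustifiedlySatisfiable S' → All JustifiedlySatisfiable S
step-reflects (node xs ys ns) sat with All.++⁻ xs sat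
... | sxs , (sF' ∷ sys) = All.++⁺ sxs (nodeStep-reflects ns sF' ∷ sys)
step-reflects (A3 xs ys us vs R F₁ units) sat with All.++⁻ xs sat
... | sxs , (sParent ∷ rest) with All.++⁻ ys rest
... | sys , (sF₁ ∷ []) = All.++⁺ sxs (a3-reflects us vs R F₁ units sParent sF₁ ∷ sys)

derivation-reflects : ∀ {S S'} → Star Step S S' →
  All JustifiedlySatisfiable S' → All JustifiedlySatisfiable S
derivation-reflects ε        sat = sat
derivation-reflects (s ◅ ss) sat = step-reflects s (derivation-reflects ss sat)

data AtomicUnit : Clause → Set where
  unitPos : ∀ A → AtomicUnit (pos A ∷ [])
  unitNeg : ∀ A → AtomicUnit (neg A ∷ [])

module _ {F : CSet} (¬A1 : ¬ A1Applicable F) (¬A2 : ¬ A2Applicable F)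
         (¬A3 : ¬ A3Applicable F) ([]∉F : [] ∉ F) where

  inert-clause-A3Unit : ∀ {C} → C ∈ F → A3Unit C
  inert-clause-A3Unit {[]}              C∈F = ⊥-elim ([]∉F C∈F)
  inert-clause-A3Unit {_ ∷ _ ∷ _}       C∈F = ⊥-elim (¬A1 (_ , C∈F , s≤s (s≤s z≤n)))
  inert-clause-A3Unit {pos A ∷ []}      _   = uPos A
  inert-clause-A3Unit {neg A ∷ []}      _   = uNeg A
  inert-clause-A3Unit {ex R G ∷ []}     _   = uEx R G
  inert-clause-A3Unit {all R G ∷ []}    C∈F = ⊥-elim (¬A2 (_ , R , G , C∈F , here refl))

  inert-clause-atomic : ∀ {C} → C ∈ F → AtomicUnit C
  inert-clause-atomic C∈F with inert-clause-A3Unit C∈F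
  ... | uPos A   = unitPos A
  ... | uNeg A   = unitNeg A
  ... | uEx R G  = ⊥-elim (¬A3 (All.tabulate inert-clause-A3Unit , R , G , C∈F))

  inert-justifiedlySatisfiable :
    (∀ L → (L ∷ []) ∈ F → (compL L ∷ []) ∈ F → ⊥) → JustifiedlySatisfiable F
  inert-justifiedlySatisfiable noClash = I , tt , satS-tabulate I F satClause , λ _ _ ()
    where
      I : Interp
      I = record { Δ = ⊤ ; conc = λ A _ → (pos A ∷ []) ∈ F ; role = λ _ _ _ → ⊥ }

      satClause : ∀ {C} → C ∈ F → satC I C tt
      satClause C∈F with inert-clause-atomic C∈F
      ... | unitPos A = inj₁ C∈F
      ... | unitNeg A = inj₁ (noClash (neg A) C∈F)

mainTheorem3 : (F : CSet) (Sn : Family) →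
    Derivation F Sn → Complete Sn → ClashFree Sn → Satisfiable F
mainTheorem3 F Sn D complete clashFree =
  satisfiable (derivation-reflects D (All.tabulate finalSat))
  where
    finalSat : ∀ {G} → G ∈ Sn → JustifiedlySatisfiable G
    finalSat {G} G∈Sn =
      let (¬A1 , ¬A2 , ¬A3) = complete G G∈Sn
          ([]∉G , noClash) = clashFree G G∈Sn
      in inert-justifiedlySatisfiable ¬A1 ¬A2 ¬A3 []∉G noClash

    satisfiable : All JustifiedlySatisfiable (F ∷ []) → Satisfiable F
    satisfiable ((I , d , sF , _) ∷ []) = I , d , sF
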